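{- For even $b\ge2$: $K_{2+2\lambda}(2)=b^2+1+2\lambda$ for $0\le\lambda\le b-2$. For odd $b\ge3$: $K_{2+2\lambda}(2)=b+1+2\lambda$ for $0\le\lambda\le\frac{b-3}{2}$.
   Context: Fix a base $b\ge2$. For $v\in\mathbb{N}$, $s(v)$ is the sum of the base-$b$ digits of $v$, $f(v)=v+s(v)$, and $F(u)=|\{v\in\mathbb{N}: f(v)=u\}|$. For a residue class $i$ modulo $b-1$ (with $i$ even if $b$ is odd), $K_i(n)$ is the smallest $u\in\mathbb{N}$ with $F(u)=n$ and $u\equiv i\pmod{b-1}$. Subscripts are read modulo $b-1$. -}

module Defs where

open import Data.Nat using (ℕ; zero; suc; _+_; _*_; _∸_; _<_; _%_; _/_)
open import Data.Nat.Properties using (_≟_)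
open import Data.List using (List; length; filter; upTo)
open import Data.Product using (∃; _×_)
open import Data.Sum using (_⊎_)
open import Relation.Binary.PropositionalEquality using (_≡_)
open import Relation.Nullary using (¬_)

-- Digit sum in base (2 + c), with fuel.  Fuel n suffices for input n,
-- since each step strictly decreases a positive argument.
digitSumAux : ℕ → ℕ → ℕ → ℕ
digitSumAux c zero    n = 0
digitSumAux c (suc k) n = n % (2 + c) + digitSumAux c k (n / (2 + c))

-- s(v): sum of base-b digits of v (junk value 0 for b < 2, never used).
s : ℕ → ℕ → ℕ
s zero          v = 0
s (suc zero)    v = 0
s (suc (suc c)) v = digitSumAux c v v

f : ℕ → ℕ → ℕ
f b v = v + s b v

-- F(u) = |{ v ∈ ℕ : f(v) = u }|.  Since f(v) ≥ v, every such v lies in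
-- {0, …, u}, so this set is exactly the filtered list below.
F : ℕ → ℕ → ℕ
F b u = length (filter (λ v → f b v ≟ u) (upTo (suc u)))

_≡_[mod_] : ℕ → ℕ → ℕ → Set
x ≡ y [mod m ] = ∃ λ k → (x ≡ y + k * m) ⊎ (y ≡ x + k * m)

-- IsK b i n u : u = K_i(n), i.e. u is the smallest natural number with
-- F(u) = n and u ≡ i (mod b - 1).
IsK : ℕ → ℕ → ℕ → ℕ → Set
IsK b i n u =
  (F b u ≡ n) × (u ≡ i [mod (b ∸ 1) ]) ×
  (∀ w → w < u → w ≡ i [mod (b ∸ 1) ] → ¬ (F b w ≡ n))

-- Writing v = d + q b with d < b, the map f
-- is v ↦ q (b + 1) + 2 d below b², injective when b + 1 is odd, while d + b² ↦ b² + 1 + 2 d and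
-- d + (b + 1) b ↦ b² + b + 2 + 2 d.  For even b, u = b² + 1 + 2λ thus has exactly the preimages
-- (λ + 1) + (b − 1) b and λ + b², and every smaller member of its class modulo b − 1 is at most
-- b² or equals b² + 2e with 2e < b, so has at most one preimage.  For odd b the same happens a
-- digit lower: u = b + 1 + 2λ has the preimages (b + 1)/2 + λ and λ + b, and the only smaller
-- member of its class is 2 + 2λ < b, where f is v ↦ 2 v.
module Submission where

open import Defs
open import Data.Nat using (ℕ; zero; suc; _+_; _*_; _∸_; _≤_; _<_; _%_; _/_; _^_; z≤n; s≤s; s≤s⁻¹)
open import Data.Nat.Properties
open import Data.Nat.DivMod
  using ( m/n<m; m/n≤m; m/n*n≤m; m%n<n; m≡m%n+[m/n]*n; [m+kn]%n≡m%n; m<n⇒m%n≡m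
        ; m<n⇒m/n≡0; m*n/n≡m; +-distrib-/-∣ʳ)
open import Data.Nat.Divisibility using (_∣_; divides; n∣m*n)
open import Data.Nat.Tactic.RingSolver using (solve-∀)
open import Data.List using ([_]; _++_; filter; length; upTo)
open import Data.List.Properties using (filter-++; length-++; upTo-∷ʳ; filter-accept; filter-reject)
open import Data.Product using (∃; ∃₂; _×_; _,_)
open import Data.Sum using (_⊎_; inj₁; inj₂; [_,_]′)
open import Function using (_∘_)
open import Relation.Binary.Definitions using (tri<; tri≈; tri>)
open import Relation.Binary.PropositionalEquality hiding ([_])
open import Relation.Nullary using (¬_; yes; no; contradiction)
open import Relation.Unary using (Decidable)

module _ {P : ℕ → Set} (P? : Decidable P) where

  count : ℕ → ℕ
  count n = length (filter P? (upTo n))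

  count-suc : ∀ n → count (suc n) ≡ count n + length (filter P? [ n ])
  count-suc n = begin
    length (filter P? (upTo (suc n)))               ≡⟨ cong (length ∘ filter P?) (upTo-∷ʳ n) ⟨
    length (filter P? (upTo n ++ [ n ]))            ≡⟨ cong length (filter-++ P? (upTo n) [ n ]) ⟩
    length (filter P? (upTo n) ++ filter P? [ n ])  ≡⟨ length-++ (filter P? (upTo n)) ⟩
    count n + length (filter P? [ n ])              ∎
    where open ≡-Reasoning

  count-suc-accept : ∀ {n} → P n → count (suc n) ≡ suc (count n)
  count-suc-accept {n} p = begin
    count (suc n)                       ≡⟨ count-suc n ⟩
    count n + length (filter P? [ n ])  ≡⟨ cong (λ xs → count n + length xs) (filter-accept P? p) ⟩
    count n + 1                         ≡⟨ +-comm (count n) 1 ⟩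
    suc (count n)                       ∎
    where open ≡-Reasoning

  count-suc-reject : ∀ {n} → ¬ P n → count (suc n) ≡ count n
  count-suc-reject {n} ¬p = begin
    count (suc n)                       ≡⟨ count-suc n ⟩
    count n + length (filter P? [ n ])  ≡⟨ cong (λ xs → count n + length xs) (filter-reject P? ¬p) ⟩
    count n + 0                         ≡⟨ +-identityʳ (count n) ⟩
    count n                             ∎
    where open ≡-Reasoning

  count-constant : ∀ {m n} → m ≤ n → (∀ {v} → m ≤ v → v < n → ¬ P v) → count n ≡ count m
  count-constant {n = zero} z≤n _ = refl
  count-constant {m} {suc n} m≤1+n absent with m≤n⇒m<n∨m≡n m≤1+n
  ... | inj₂ refl        = refl
  ... | inj₁ (s≤s m≤n) = trans (count-suc-reject (absent m≤n ≤-refl))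
                               (count-constant m≤n (λ m≤v v<n → absent m≤v (m<n⇒m<1+n v<n)))

  count-≤1 : (∀ {v v′} → P v → P v′ → v ≡ v′) → ∀ n → count n ≤ 1
  count-≤1 unique zero = z≤n
  count-≤1 unique (suc n) with P? n
  ... | yes p  = ≤-reflexive (trans (count-suc-accept p)
                   (cong suc (count-constant z≤n (λ _ v<n pv → <⇒≢ v<n (unique pv p)))))
  ... | no ¬p = subst (_≤ 1) (sym (count-suc-reject ¬p)) (count-≤1 unique n)

  count-≡2 : ∀ {a c n} → a < c → c < n → P a → P c → (∀ {v} → P v → v ≡ a ⊎ v ≡ c) →
             count n ≡ 2
  count-≡2 {a} {c} {n} a<c c<n pa pc only = begin
    count n              ≡⟨ count-constant c<n (λ c<v _ → absent (>⇒≢ (<-trans a<c c<v)) (>⇒≢ c<v)) ⟩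
    count (suc c)        ≡⟨ count-suc-accept pc ⟩
    suc (count c)        ≡⟨ cong suc (count-constant a<c (λ a<v v<c → absent (>⇒≢ a<v) (<⇒≢ v<c))) ⟩
    suc (count (suc a))  ≡⟨ cong suc (count-suc-accept pa) ⟩
    2 + count a          ≡⟨ cong (2 +_) (count-constant z≤n (λ _ v<a →
                              absent (<⇒≢ v<a) (<⇒≢ (<-trans v<a a<c)))) ⟩
    2                    ∎
    where
    open ≡-Reasoning
    absent : ∀ {v} → v ≢ a → v ≢ c → ¬ P v
    absent v≢a v≢c pv = [ v≢a , v≢c ]′ (only pv)

preimage-≤ : ∀ b v {u} → f b v ≡ u → v ≤ u
preimage-≤ b v refl = m≤m+n v (s b v)

F-≤1 : ∀ {b w} → (∀ {v v′} → f b v ≡ w → f b v′ ≡ w → v ≡ v′) → F b w ≤ 1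
F-≤1 {b} {w} unique = count-≤1 (λ v → f b v ≟ w) unique (suc w)

F-≡2 : ∀ {b u a c} → a < c → f b a ≡ u → f b c ≡ u → (∀ {v} → f b v ≡ u → v ≡ a ⊎ v ≡ c) →
       F b u ≡ 2
F-≡2 {b} {u} {c = c} a<c fa fc only =
  count-≡2 (λ v → f b v ≟ u) a<c (s≤s (preimage-≤ b c fc)) fa fc only

m+o≡n⇒m≤n : ∀ {m n o} → m + o ≡ n → m ≤ n
m+o≡n⇒m≤n {m} {o = o} refl = m≤m+n m o

last-block : ∀ m q {v} → v < suc q * m → v < q * m ⊎ ∃ λ d → d < m × v ≡ d + q * m
last-block m q {v} v<[1+q]m with v <? q * m
... | yes v<qm = inj₁ v<qm
... | no v≮qm with m≤n⇒∃[o]m+o≡n (≮⇒≥ v≮qm)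
...   | d , refl = inj₂ (d , +-cancelˡ-< (q * m) d m (subst (q * m + d <_) (+-comm m (q * m)) v<[1+q]m)
                          , +-comm (q * m) d)

congruent-below : ∀ {x y m} j → x ≡ y [mod m ] → x < y + suc j * m → x ≤ y + j * m
congruent-below {x} {y} {m} j (t , inj₂ y≡x+tm) _ =
  ≤-trans (m≤m+n x (t * m)) (≤-trans (≤-reflexive (sym y≡x+tm)) (m≤m+n y (j * m)))
congruent-below {y = y} {m} j (t , inj₁ refl) x<y+[1+j]m =
  +-monoʳ-≤ y (*-monoˡ-≤ m (s≤s⁻¹ (*-cancelʳ-< m t (suc j) (+-cancelˡ-< y _ _ x<y+[1+j]m))))

-- The carry case q′ = q + 1 is excluded by parity, larger gaps by size.
radix-gap : ∀ {m q q′ d d′} n → m ≡ suc (2 * n) → q < q′ → d < m →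
            q * m + 2 * d ≢ q′ * m + 2 * d′
radix-gap {m} {q} {d = d} {d′} n refl q<q′ d<m eq with m≤n⇒∃[o]m+o≡n q<q′
... | t , refl = gap t (+-cancelˡ-≡ (q * m) _ _ (trans eq (split n q t d′)))
  where
  split : ∀ n q t d′ → (suc q + t) * suc (2 * n) + 2 * d′
                     ≡ q * suc (2 * n) + (suc t * suc (2 * n) + 2 * d′)
  split = solve-∀
  odd : ∀ n d′ → suc (2 * n) + 0 * suc (2 * n) + 2 * d′ ≡ suc (2 * (n + d′))
  odd = solve-∀
  gap : ∀ t → 2 * d ≢ suc t * m + 2 * d′
  gap zero e = even≢odd d (n + d′) (trans e (odd n d′))
  gap (suc t) e = <-irrefl e (<-≤-trans (*-monoʳ-< 2 d<m) (≤-trans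
                    (*-monoˡ-≤ m (s≤s (s≤s (z≤n {t})))) (m≤m+n (suc (suc t) * m) (2 * d′))))

odd-radix-injective : ∀ {m q q′ d d′} n → m ≡ suc (2 * n) → d < m → d′ < m →
                      q * m + 2 * d ≡ q′ * m + 2 * d′ → q ≡ q′ × d ≡ d′
odd-radix-injective {q = q} {q′} {d} {d′} n m-odd d<m d′<m eq with <-cmp q q′
... | tri< q<q′ _ _ = contradiction eq (radix-gap {d′ = d′} n m-odd q<q′ d<m)
... | tri> _ _ q′<q = contradiction (sym eq) (radix-gap {d′ = d} n m-odd q′<q d′<m)
... | tri≈ _ refl _ = refl , *-cancelˡ-≡ d d′ 2 (+-cancelˡ-≡ (q * _) _ _ eq)

module Digits (c : ℕ) where

  B : ℕ
  B = 2 + c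

  1<B : 1 < B
  1<B = s≤s (s≤s z≤n)

  digitSumAux-zero : ∀ k → digitSumAux c k 0 ≡ 0
  digitSumAux-zero zero    = refl
  digitSumAux-zero (suc k) = digitSumAux-zero k

  digitSumAux-fuel : ∀ {k k′} n → n ≤ k → n ≤ k′ → digitSumAux c k n ≡ digitSumAux c k′ n
  digitSumAux-fuel {k} {k′} zero _ _ = trans (digitSumAux-zero k) (sym (digitSumAux-zero k′))
  digitSumAux-fuel {suc k} {suc k′} n@(suc n-1) (s≤s n-1≤k) (s≤s n-1≤k′) =
    cong (n % B +_) (digitSumAux-fuel (n / B) (shrink n-1≤k) (shrink n-1≤k′))
    where
    shrink : ∀ {j} → n-1 ≤ j → n / B ≤ j
    shrink = ≤-trans (s≤s⁻¹ (m/n<m n B 1<B))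

  s-step : ∀ v → s B v ≡ v % B + s B (v / B)
  s-step v = begin
    digitSumAux c v v                      ≡⟨ digitSumAux-fuel v ≤-refl (n≤1+n v) ⟩
    v % B + digitSumAux c v (v / B)
      ≡⟨ cong (v % B +_) (digitSumAux-fuel (v / B) (m/n≤m v B) ≤-refl) ⟩
    v % B + digitSumAux c (v / B) (v / B)  ∎
    where open ≡-Reasoning

  s-digit : ∀ q {d} → d < B → s B (d + q * B) ≡ d + s B q
  s-digit q {d} d<B = begin
    s B (d + q * B)                          ≡⟨ s-step (d + q * B) ⟩
    (d + q * B) % B + s B ((d + q * B) / B)  ≡⟨ cong₂ (λ x y → x + s B y) last-digit leading-digits ⟩
    d + s B q                                ∎
    where
    open ≡-Reasoning
    last-digit : (d + q * B) % B ≡ d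
    last-digit = trans ([m+kn]%n≡m%n d q B) (m<n⇒m%n≡m d<B)
    leading-digits : (d + q * B) / B ≡ q
    leading-digits = trans (+-distrib-/-∣ʳ d (n∣m*n q)) (cong₂ _+_ (m<n⇒m/n≡0 d<B) (m*n/n≡m q B))

  s-small : ∀ {d} → d < B → s B d ≡ d
  s-small {d} d<B = begin
    s B d        ≡⟨ cong (s B) (+-identityʳ d) ⟨
    s B (d + 0)  ≡⟨ s-digit 0 d<B ⟩
    d + 0        ≡⟨ +-identityʳ d ⟩
    d            ∎
    where open ≡-Reasoning

  s-[d+B] : ∀ {d} → d < B → s B (d + B) ≡ suc d
  s-[d+B] {d} d<B = begin
    s B (d + B)      ≡⟨ cong (λ x → s B (d + x)) (*-identityˡ B) ⟨
    s B (d + 1 * B)  ≡⟨ s-digit 1 d<B ⟩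
    d + s B 1        ≡⟨ cong (d +_) (s-small 1<B) ⟩
    d + 1            ≡⟨ +-comm d 1 ⟩
    suc d            ∎
    where open ≡-Reasoning

  f-oneDigit : ∀ {d} → d < B → f B d ≡ 2 * d
  f-oneDigit {d} d<B = cong (d +_) (trans (s-small d<B) (sym (+-identityʳ d)))

  f-twoDigit : ∀ {q d} → q < B → d < B → f B (d + q * B) ≡ q * suc B + 2 * d
  f-twoDigit {q} {d} q<B d<B = begin
    d + q * B + s B (d + q * B)  ≡⟨ cong (d + q * B +_) (s-digit q d<B) ⟩
    d + q * B + (d + s B q)      ≡⟨ cong (λ x → d + q * B + (d + x)) (s-small q<B) ⟩
    d + q * B + (d + q)          ≡⟨ collect d q B ⟩
    q * suc B + 2 * d            ∎
    where
    open ≡-Reasoning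
    collect : ∀ d q b → d + q * b + (d + q) ≡ q * suc b + 2 * d
    collect = solve-∀

  f-[d+B²] : ∀ {d} → d < B → f B (d + B * B) ≡ B * B + suc (2 * d)
  f-[d+B²] {d} d<B = begin
    d + B * B + s B (d + B * B)  ≡⟨ cong (d + B * B +_) (s-digit B d<B) ⟩
    d + B * B + (d + s B B)      ≡⟨ cong (λ x → d + B * B + (d + x)) (s-[d+B] {0} (s≤s z≤n)) ⟩
    d + B * B + (d + 1)          ≡⟨ collect d B ⟩
    B * B + suc (2 * d)          ∎
    where
    open ≡-Reasoning
    collect : ∀ d b → d + b * b + (d + 1) ≡ b * b + suc (2 * d)
    collect = solve-∀

  f-[d+B+B²] : ∀ {d} → d < B → f B (d + suc B * B) ≡ B * B + (B + 2 * suc d)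
  f-[d+B+B²] {d} d<B = begin
    d + suc B * B + s B (d + suc B * B)  ≡⟨ cong (d + suc B * B +_) (s-digit (suc B) d<B) ⟩
    d + suc B * B + (d + s B (suc B))    ≡⟨ cong (λ x → d + suc B * B + (d + x)) (s-[d+B] 1<B) ⟩
    d + suc B * B + (d + 2)              ≡⟨ collect d B ⟩
    B * B + (B + 2 * suc d)              ∎
    where
    open ≡-Reasoning
    collect : ∀ d b → d + suc b * b + (d + 2) ≡ b * b + (b + 2 * suc d)
    collect = solve-∀

  twoDigit-view : ∀ {v} → v < B * B → ∃₂ λ q d → q < B × d < B × v ≡ d + q * B
  twoDigit-view {v} v<B² =
    v / B , v % B , *-cancelʳ-< B (v / B) B (≤-<-trans (m/n*n≤m v B) v<B²) ,
    m%n<n v B , m≡m%n+[m/n]*n v B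

  F-≤1-belowBase : ∀ {w} → w < B → F B w ≤ 1
  F-≤1-belowBase {w} w<B = F-≤1 λ {v} {v′} fv fv′ → *-cancelˡ-≡ v v′ 2 (begin
    2 * v   ≡⟨ f-oneDigit (below v fv) ⟨
    f B v   ≡⟨ trans fv (sym fv′) ⟩
    f B v′  ≡⟨ f-oneDigit (below v′ fv′) ⟩
    2 * v′  ∎)
    where
    open ≡-Reasoning
    below : ∀ v → f B v ≡ w → v < B
    below v fv = ≤-<-trans (preimage-≤ B v fv) w<B

module Even (k : ℕ) where
  open Digits (2 * k)

  1+B-odd : suc B ≡ suc (2 * suc k)
  1+B-odd = cong suc (sym (*-suc 2 k))

  f-injective-belowSquare : ∀ {v v′} → v < B * B → v′ < B * B → f B v ≡ f B v′ → v ≡ v′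
  f-injective-belowSquare v<B² v′<B² eq with twoDigit-view v<B² | twoDigit-view v′<B²
  ... | q , d , q<B , d<B , refl | q′ , d′ , q′<B , d′<B , refl
    with odd-radix-injective {q = q} {q′} (suc k) 1+B-odd (m<n⇒m<1+n d<B) (m<n⇒m<1+n d′<B)
           (trans (sym (f-twoDigit q<B d<B)) (trans eq (f-twoDigit q′<B d′<B)))
  ... | refl , refl = refl

  F-≤1-ofPreimagesBelowSquare : ∀ {w} → (∀ v → f B v ≡ w → v < B * B) → F B w ≤ 1
  F-≤1-ofPreimagesBelowSquare below =
    F-≤1 λ {v} {v′} fv fv′ →
      f-injective-belowSquare (below v fv) (below v′ fv′) (trans fv (sym fv′))

  F-[B²+2e]-≤1 : ∀ {e} → 2 * e < B → F B (B * B + 2 * e) ≤ 1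
  F-[B²+2e]-≤1 {e} 2e<B = F-≤1-ofPreimagesBelowSquare below
    where
    bound : B * B + 2 * e < suc B * B
    bound = subst (B * B + 2 * e <_) (+-comm (B * B) B) (+-monoʳ-< (B * B) 2e<B)
    below : ∀ v → f B v ≡ B * B + 2 * e → v < B * B
    below v fv with last-block B B (≤-<-trans (preimage-≤ B v fv) bound)
    ... | inj₁ v<B² = v<B²
    ... | inj₂ (d , d<B , refl) =
      contradiction (+-cancelˡ-≡ (B * B) _ _ (trans (sym fv) (f-[d+B²] d<B))) (even≢odd e d)

  F-≤1-upToSquare : ∀ {w} → w ≤ B * B → F B w ≤ 1
  F-≤1-upToSquare w≤B² with m≤n⇒m<n∨m≡n w≤B²
  ... | inj₁ w<B² = F-≤1-ofPreimagesBelowSquare (λ v fv → ≤-<-trans (preimage-≤ B v fv) w<B²)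
  ... | inj₂ refl = subst (λ x → F B x ≤ 1) (+-identityʳ (B * B)) (F-[B²+2e]-≤1 {0} (s≤s z≤n))

  F-[B²+1+2l]≡2 : ∀ {l} → l ≤ 2 * k → F B (B * B + suc (2 * l)) ≡ 2
  F-[B²+1+2l]≡2 {l} l≤2k = F-≡2 a<c f-a f-c only
    where
    u : ℕ
    u = B * B + suc (2 * l)
    a : ℕ
    a = suc l + suc (2 * k) * B
    c : ℕ
    c = l + B * B
    1+l<B : suc l < B
    1+l<B = s≤s (s≤s l≤2k)
    l<B : l < B
    l<B = <-trans (n<1+n l) 1+l<B
    f-a : f B a ≡ u
    f-a = trans (f-twoDigit ≤-refl 1+l<B) (expand k l)
      where
      expand : ∀ k l → suc (2 * k) * (3 + 2 * k) + 2 * suc l ≡ (2 + 2 * k) * (2 + 2 * k) + suc (2 * l)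
      expand = solve-∀
    f-c : f B c ≡ u
    f-c = f-[d+B²] l<B
    a<c : a < c
    a<c = m+o≡n⇒m≤n (expand k l)
      where
      expand : ∀ k l → suc (suc l + suc (2 * k) * (2 + 2 * k)) + 2 * k ≡ l + (2 + 2 * k) * (2 + 2 * k)
      expand = solve-∀
    u<[2+B]B : u < suc (suc B) * B
    u<[2+B]B = begin-strict
      B * B + suc (2 * l)  <⟨ +-monoʳ-< (B * B) (subst (_≤ 2 * B) (*-suc 2 l) (*-monoʳ-≤ 2 l<B)) ⟩
      B * B + 2 * B        ≡⟨ collect B ⟩
      suc (suc B) * B      ∎
      where
      open ≤-Reasoning
      collect : ∀ b → b * b + 2 * b ≡ suc (suc b) * b
      collect = solve-∀
    odd-offset : ∀ {d} → B + 2 * suc d ≢ suc (2 * l)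
    odd-offset {d} eq = even≢odd (suc k + suc d) l (trans (regroup k d) eq)
      where
      regroup : ∀ k d → 2 * (suc k + suc d) ≡ (2 + 2 * k) + 2 * suc d
      regroup = solve-∀
    only : ∀ {v} → f B v ≡ u → v ≡ a ⊎ v ≡ c
    only {v} fv with last-block B (suc B) {v} (≤-<-trans (preimage-≤ B v fv) u<[2+B]B)
    ... | inj₂ (d , d<B , refl) =
      contradiction (+-cancelˡ-≡ (B * B) _ _ (trans (sym (f-[d+B+B²] d<B)) fv)) odd-offset
    ... | inj₁ v<[1+B]B with last-block B B {v} v<[1+B]B
    ...   | inj₁ v<B² = inj₁ (f-injective-belowSquare v<B² (+-monoˡ-< (suc (2 * k) * B) 1+l<B)
                                                         (trans fv (sym f-a)))
    ...   | inj₂ (d , d<B , refl) = inj₂ (cong (_+ B * B) (*-cancelˡ-≡ d l 2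
              (suc-injective (+-cancelˡ-≡ (B * B) _ _ (trans (sym (f-[d+B²] d<B)) fv)))))

  u-residue : ∀ l → B * B + suc (2 * l) ≡ 2 + 2 * l + suc B * (B ∸ 1)
  u-residue l = expand k l
    where
    expand : ∀ k l → (2 + 2 * k) * (2 + 2 * k) + suc (2 * l) ≡ 2 + 2 * l + (3 + 2 * k) * suc (2 * k)
    expand = solve-∀

  -- Below u the class of 2 + 2l passes B² only at 2 + 2l + B (B − 1) = B² + 2 (l − k), when l > k.
  F-≤1-belowCandidate : ∀ {l w} → l ≤ 2 * k → w < B * B + suc (2 * l) →
                        w ≡ 2 + 2 * l [mod B ∸ 1 ] → F B w ≤ 1
  F-≤1-belowCandidate {l} {w} l≤2k w<u w≡i
    with m≤n⇒m<n∨m≡n (congruent-below B w≡i (subst (w <_) (u-residue l) w<u))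
  ... | inj₁ w<i+BM = F-≤1-upToSquare (≤-trans (congruent-below (suc (2 * k)) w≡i w<i+BM) i+M²≤B²)
    where
    i+M²≤B² : 2 + 2 * l + suc (2 * k) * suc (2 * k) ≤ B * B
    i+M²≤B² = begin
      2 + 2 * l + suc (2 * k) * suc (2 * k)        ≤⟨ +-monoˡ-≤ _ (s≤s (s≤s (*-monoʳ-≤ 2 l≤2k))) ⟩
      2 + 2 * (2 * k) + suc (2 * k) * suc (2 * k)  ≤⟨ m+o≡n⇒m≤n (expand k) ⟩
      B * B                                        ∎
      where
      open ≤-Reasoning
      expand : ∀ k → 2 + 2 * (2 * k) + suc (2 * k) * suc (2 * k) + 1 ≡ (2 + 2 * k) * (2 + 2 * k)
      expand = solve-∀
  ... | inj₂ refl with l ≤? k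
  ...   | yes l≤k = F-≤1-upToSquare (begin
      2 + 2 * l + B * suc (2 * k)  ≤⟨ +-monoˡ-≤ _ (s≤s (s≤s (*-monoʳ-≤ 2 l≤k))) ⟩
      2 + 2 * k + B * suc (2 * k)  ≡⟨ expand k ⟩
      B * B                        ∎)
    where
    open ≤-Reasoning
    expand : ∀ k → 2 + 2 * k + (2 + 2 * k) * suc (2 * k) ≡ (2 + 2 * k) * (2 + 2 * k)
    expand = solve-∀
  ...   | no l≰k with m≤n⇒∃[o]m+o≡n (≰⇒> l≰k)
  ...     | y , refl = subst (λ x → F B x ≤ 1) (sym (expand k y)) (F-[B²+2e]-≤1 {suc y} 2+2y<B)
    where
    expand : ∀ k y → 2 + 2 * (suc k + y) + (2 + 2 * k) * suc (2 * k)
                   ≡ (2 + 2 * k) * (2 + 2 * k) + 2 * suc y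
    expand = solve-∀
    1+y≤k : suc y ≤ k
    1+y≤k = +-cancelˡ-≤ k (suc y) k (begin
      k + suc y      ≡⟨ +-suc k y ⟩
      suc k + y      ≤⟨ l≤2k ⟩
      2 * k          ≡⟨ cong (k +_) (+-identityʳ k) ⟩
      k + k          ∎)
      where open ≤-Reasoning
    2+2y<B : 2 * suc y < B
    2+2y<B = s≤s (m≤n⇒m≤1+n (*-monoʳ-≤ 2 1+y≤k))

  K-two : ∀ {l} → l ≤ 2 * k → IsK B (2 + 2 * l) 2 (B * B + suc (2 * l))
  K-two {l} l≤2k = F-[B²+1+2l]≡2 l≤2k , (suc B , inj₁ (u-residue l)) ,
               λ w w<u w≡i → <⇒≢ (s≤s (F-≤1-belowCandidate l≤2k w<u w≡i))

module Odd (k : ℕ) where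
  open Digits (suc (2 * k))

  1+2l<B : ∀ {l} → l ≤ k → suc (2 * l) < B
  1+2l<B l≤k = s≤s (s≤s (m≤n⇒m≤1+n (*-monoʳ-≤ 2 l≤k)))

  F-[B+1+2l]≡2 : ∀ {l} → l ≤ k → F B (B + suc (2 * l)) ≡ 2
  F-[B+1+2l]≡2 {l} l≤k = F-≡2 a<c f-a f-c only
    where
    u : ℕ
    u = B + suc (2 * l)
    a : ℕ
    a = suc (suc (k + l))
    c : ℕ
    c = l + 1 * B
    a<B : a < B
    a<B = s≤s (s≤s (s≤s (≤-trans (+-monoʳ-≤ k l≤k)
                                 (≤-reflexive (cong (k +_) (sym (+-identityʳ k)))))))
    l<B : l < B
    l<B = ≤-<-trans (m≤n+m l (suc (suc k))) a<B
    f-a : f B a ≡ u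
    f-a = trans (f-oneDigit a<B) (expand k l)
      where
      expand : ∀ k l → 2 * suc (suc (k + l)) ≡ (3 + 2 * k) + suc (2 * l)
      expand = solve-∀
    f-c : f B c ≡ u
    f-c = trans (f-twoDigit 1<B l<B) (expand k l)
      where
      expand : ∀ k l → 1 * (4 + 2 * k) + 2 * l ≡ (3 + 2 * k) + suc (2 * l)
      expand = solve-∀
    a<c : a < c
    a<c = m+o≡n⇒m≤n (expand k l)
      where
      expand : ∀ k l → suc (suc (suc (k + l))) + k ≡ l + 1 * (3 + 2 * k)
      expand = solve-∀
    u<2B : u < 2 * B
    u<2B = +-monoʳ-< B (subst (suc (2 * l) <_) (sym (+-identityʳ B)) (1+2l<B l≤k))
    only : ∀ {v} → f B v ≡ u → v ≡ a ⊎ v ≡ c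
    only {v} fv with last-block B 1 {v} (≤-<-trans (preimage-≤ B v fv) u<2B)
    ... | inj₁ v<1*B = inj₁ (*-cancelˡ-≡ v a 2
            (trans (sym (f-oneDigit v<B)) (trans (trans fv (sym f-a)) (f-oneDigit a<B))))
      where
      v<B : v < B
      v<B = subst (v <_) (*-identityˡ B) v<1*B
    ... | inj₂ (d , d<B , refl) = inj₂ (cong (_+ 1 * B) (*-cancelˡ-≡ d l 2 (+-cancelˡ-≡ (1 * suc B) _ _
            (trans (sym (f-twoDigit 1<B d<B)) (trans (trans fv (sym f-c)) (f-twoDigit 1<B l<B))))))

  u-residue : ∀ l → B + suc (2 * l) ≡ 2 + 2 * l + 1 * (B ∸ 1)
  u-residue l = expand k l
    where
    expand : ∀ k l → (3 + 2 * k) + suc (2 * l) ≡ 2 + 2 * l + 1 * (2 + 2 * k)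
    expand = solve-∀

  F-≤1-belowCandidate : ∀ {l w} → l ≤ k → w < B + suc (2 * l) →
                        w ≡ 2 + 2 * l [mod B ∸ 1 ] → F B w ≤ 1
  F-≤1-belowCandidate {l} {w} l≤k w<u w≡i =
    F-≤1-belowBase (≤-<-trans (congruent-below 0 w≡i (subst (w <_) (u-residue l) w<u)) i<B)
    where
    i<B : 2 + 2 * l + 0 < B
    i<B = subst (_< B) (sym (+-identityʳ _)) (s≤s (s≤s (s≤s (*-monoʳ-≤ 2 l≤k))))

  K-two : ∀ {l} → l ≤ k → IsK B (2 + 2 * l) 2 (B + suc (2 * l))
  K-two {l} l≤k = F-[B+1+2l]≡2 l≤k , (1 , inj₁ (u-residue l)) ,
              λ w w<u w≡i → <⇒≢ (s≤s (F-≤1-belowCandidate l≤k w<u w≡i))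

even-form : ∀ {b} → 2 ≤ b → 2 ∣ b → ∃ λ k → b ≡ 2 + 2 * k
even-form () (divides zero refl)
even-form _  (divides (suc k) refl) = k , cong (2 +_) (*-comm k 2)

odd-form : ∀ {b} → 2 ≤ b → ¬ 2 ∣ b → ∃ λ k → b ≡ 3 + 2 * k
odd-form {b} 2≤b 2∤b with b % 2 | m%n<n b 2 | m≡m%n+[m/n]*n b 2
... | 0 | _ | b≡[b/2]*2 = contradiction (divides (b / 2) b≡[b/2]*2) 2∤b
... | suc (suc _) | s≤s (s≤s ()) | _
... | 1 | _ | b≡1+[b/2]*2 with b / 2
...   | zero  = contradiction (≤-trans 2≤b (≤-reflexive b≡1+[b/2]*2)) λ { (s≤s ()) }
...   | suc k = k , trans b≡1+[b/2]*2 (cong (3 +_) (*-comm k 2))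

theorem4p6 : ∀ (b : ℕ) → 2 ≤ b →
    ((2 ∣ b) → ∀ (l : ℕ) → l ≤ b ∸ 2 →
       IsK b (2 + 2 * l) 2 (b ^ 2 + 1 + 2 * l))
  × ((¬ (2 ∣ b)) → ∀ (l : ℕ) → l ≤ (b ∸ 3) / 2 →
       IsK b (2 + 2 * l) 2 (b + 1 + 2 * l))
theorem4p6 b 2≤b = even-case , odd-case
  where
  even-case : 2 ∣ b → ∀ l → l ≤ b ∸ 2 → IsK b (2 + 2 * l) 2 (b ^ 2 + 1 + 2 * l)
  even-case 2∣b l l≤b∸2 with even-form 2≤b 2∣b
  ... | k , refl = subst (IsK (2 + 2 * k) (2 + 2 * l) 2) (square-form (2 + 2 * k) l)
                     (Even.K-two k {l} l≤b∸2)
    where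
    square-form : ∀ b l → b * b + suc (2 * l) ≡ b * (b * 1) + 1 + 2 * l
    square-form = solve-∀
  odd-case : ¬ 2 ∣ b → ∀ l → l ≤ (b ∸ 3) / 2 → IsK b (2 + 2 * l) 2 (b + 1 + 2 * l)
  odd-case 2∤b l l≤[b∸3]/2 with odd-form 2≤b 2∤b
  ... | k , refl = subst (IsK (3 + 2 * k) (2 + 2 * l) 2) (sym (+-assoc (3 + 2 * k) 1 (2 * l)))
                     (Odd.K-two k {l} (≤-trans l≤[b∸3]/2 (≤-reflexive half)))
    where
    half : 2 * k / 2 ≡ k
    half = trans (cong (_/ 2) (*-comm 2 k)) (m*n/n≡m k 2)
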